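{- Let $v\in\{a,b\}^*$. All Christoffel words $a\psi(z)b$ with $z\in\{v,\tilde v,\bar v,\tilde{\bar v}\}$ have the same depth.
   Context: $\tilde v$ denotes the reversal of $v$ and $\bar v$ the word obtained from $v$ by exchanging $a$ and $b$. Palindromization map: $\psi(\varepsilon)=\varepsilon$, $\psi(ux)=(\psi(u)x)^{(+)}$, $z^{(+)}$ the shortest palindrome with prefix $z$. Proper Christoffel words are $a\psi(u)b$, $u\in\{a,b\}^*$; Christoffel words also include the letters. Write nonempty $u$ uniquely as $x_0^{\alpha_0}\cdots x_m^{\alpha_m}$, $\alpha_i\ge1$, $x_{i+1}\ne x_i$; the index of $a\psi(u)b$ is $\alpha_0$ ($0$ if $u=\varepsilon$). With $\varphi_k:a\mapsto a^{k+1}b,\ b\mapsto a^kb$ and $\hat\varphi_k:a\mapsto ab^k,\ b\mapsto ab^{k+1}$, the derivative of $w=a\psi(u)b$ of index $k$ is $\partial ab=a$ if $k=0$, $\partial w=\varphi_k^{ -1}(w)$ if $k>0$ and $u$ begins with $a$, $\partial w=\hat\varphi_k^{ -1}(w)$ if $k>0$ and $u$ begins with $b$; it is a shorter Christoffel word. $\partial^{i+1}w=\partial(\partial^iw)$ while $\partial^iw$ is proper; the depth of $w$ is the least $d$ with $\partial^dw$ a single letter. -}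

module Defs where

open import Data.Nat using (ℕ; zero; suc; _≤_)
open import Data.List using (List; []; _∷_; _++_; reverse; take; length; concatMap)
open import Data.Bool using (Bool; true; false; if_then_else_)
open import Data.Product using (Σ; _×_; _,_)
open import Relation.Binary.PropositionalEquality using (_≡_)

data Letter : Set where
  a b : Letter

Word : Set
Word = List Letter

_==L_ : Letter → Letter → Bool
a ==L a = true
b ==L b = true
_ ==L _ = false

_==W_ : Word → Word → Bool
[] ==W [] = true
(x ∷ u) ==W (y ∷ v) = if x ==L y then u ==W v else false
_ ==W _ = false

rev : Word → Word
rev = reverse

swapL : Letter → Letter
swapL a = b
swapL b = a

bar : Word → Word
bar [] = []
bar (x ∷ u) = swapL x ∷ bar u

isPal : Word → Bool
isPal z = reverse z ==W z

-- z⁽⁺⁾ : shortest palindrome having z as a prefix.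
-- A palindrome with prefix z of length |z| + k (k ≤ |z|) is necessarily
-- z ++ reverse (take k z); we take the least k for which this is a palindrome
-- (k = |z| always works).
plusGo : Word → ℕ → ℕ → Word
plusGo z k zero = z ++ reverse z
plusGo z k (suc fuel) =
  if isPal (z ++ reverse (take k z)) then z ++ reverse (take k z)
  else plusGo z (suc k) fuel

pclos : Word → Word
pclos z = plusGo z 0 (suc (length z))

psiAcc : Word → Word → Word
psiAcc acc [] = acc
psiAcc acc (x ∷ u) = psiAcc (pclos (acc ++ (x ∷ []))) u

psi : Word → Word
psi = psiAcc []

chr : Word → Word
chr u = a ∷ (psi u ++ (b ∷ []))

-- index of a ψ(u) b for nonempty u = x ∷ u' : length α₀ of the first run
runFrom : Letter → Word → ℕ
runFrom x [] = zero
runFrom x (y ∷ u) = if x ==L y then suc (runFrom x u) else zero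

index : Word → ℕ
index [] = zero
index (x ∷ u) = suc (runFrom x u)

rep : ℕ → Letter → Word
rep zero x = []
rep (suc n) x = x ∷ rep n x

φl : ℕ → Letter → Word
φl k a = rep (suc k) a ++ (b ∷ [])
φl k b = rep k a ++ (b ∷ [])

φ : ℕ → Word → Word
φ k = concatMap (φl k)

φ̂l : ℕ → Letter → Word
φ̂l k a = a ∷ rep k b
φ̂l k b = a ∷ rep (suc k) b

φ̂ : ℕ → Word → Word
φ̂ k = concatMap (φ̂l k)

-- Derivative relation: Deriv w w' means w is a proper Christoffel word and ∂w = w'.
-- (φ_k, φ̂_k are injective, so φ_k⁻¹(w) is the unique w' with φ_k(w') = w.)
data Deriv : Word → Word → Set where
  d-ab : Deriv (chr []) (a ∷ [])
  d-a  : (u w' : Word) → φ (index (a ∷ u)) w' ≡ chr (a ∷ u) → Deriv (chr (a ∷ u)) w'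
  d-b  : (u w' : Word) → φ̂ (index (b ∷ u)) w' ≡ chr (b ∷ u) → Deriv (chr (b ∷ u)) w'

data Iter : ℕ → Word → Word → Set where
  it0 : {w : Word} → Iter zero w w
  itS : {n : ℕ} {w w' w'' : Word} → Deriv w w' → Iter n w' w'' → Iter (suc n) w w''

data IsLetter : Word → Set where
  isLetter : (x : Letter) → IsLetter (x ∷ [])

HasDepth : Word → ℕ → Set
HasDepth w d =
  (Σ Word λ w' → Iter d w w' × IsLetter w') ×
  ((d' : ℕ) (w' : Word) → Iter d' w w' → IsLetter w' → d ≤ d')

-- Justin's formula ψ(au) = μa(ψ(u)) a, with μa : a ↦ a, b ↦ ab, says that
-- a ψ(au) b = μa(a ψ(u) b).  Exchanging letters, a ψ(ū) b is the image of
-- a ψ(u) b under reversal-with-exchange, which gives a ψ(bu) b = μb(a ψ(u) b)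
-- with μb : a ↦ ab, b ↦ b.  As φ_k = μa^k ∘ μb, the Christoffel word of
-- a^(k+1) b w is φ_(k+1) of that of w, and since the morphisms are injective and
-- the index is visible in the word, this is its derivative.  So each derivation
-- strips the first run of u and the letter after it, and the depth is a greedy
-- count over the letter changes of u, which is invariant under reversal.
-- Reversal-with-exchange turns φ_k-derivations into φ̂_k-derivations, so it
-- preserves depth; this handles v̄ and the reversal of v̄, which is the
-- exchange of ṽ.
module Submission where

open import Data.Bool using (Bool; true; false; not)
open import Data.Empty using (⊥-elim)
open import Data.List using (List; []; _∷_; _++_; reverse; take; drop; length; map; concatMap; initLast; _∷ʳ′_)
open import Data.List.Properties
  using (++-assoc; ++-identityʳ; ++-cancelˡ; ++-cancelʳ; ++-conicalʳ; ∷-injective; ∷-injectiveˡ; ∷-injectiveʳ;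
         concatMap-++; reverse-++; reverse-involutive; reverse-map; unfold-reverse;
         map-++; length-++; length-++-≤ˡ; length-map; length-take; take++drop≡id)
open import Data.Nat using (ℕ; zero; suc; _≤_; _<_; z≤n; s≤s; _+_)
open import Data.Nat.Properties
  using (+-comm; ≤-refl; ≤-trans; ≤-reflexive; ≤-antisym; <⇒≱; m≤n⇒m<n∨m≡n; +-suc; +-identityʳ; m⊓n≤m; +-monoˡ-≤)
open import Data.Product using (Σ; ∃; ∃₂; _×_; _,_; proj₁)
open import Data.Sum using (inj₁; inj₂)
open import Function using (_∘_)
open import Relation.Binary.PropositionalEquality
  using (_≡_; _≢_; refl; sym; trans; cong; cong₂; subst; subst₂; module ≡-Reasoning)
open ≡-Reasoning

open import Defs

-- Letter exchange and reversal

swapL-involutive : ∀ x → swapL (swapL x) ≡ x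
swapL-involutive a = refl
swapL-involutive b = refl

bar≡map : ∀ u → bar u ≡ map swapL u
bar≡map [] = refl
bar≡map (x ∷ u) = cong (swapL x ∷_) (bar≡map u)

bar-++ : ∀ u v → bar (u ++ v) ≡ bar u ++ bar v
bar-++ u v = trans (bar≡map (u ++ v)) (trans (map-++ swapL u v) (sym (cong₂ _++_ (bar≡map u) (bar≡map v))))

bar-involutive : ∀ u → bar (bar u) ≡ u
bar-involutive [] = refl
bar-involutive (x ∷ u) = cong₂ _∷_ (swapL-involutive x) (bar-involutive u)

bar-reverse : ∀ u → bar (reverse u) ≡ reverse (bar u)
bar-reverse u = begin
  bar (reverse u)        ≡⟨ bar≡map (reverse u) ⟩
  map swapL (reverse u)  ≡⟨ reverse-map swapL u ⟩
  reverse (map swapL u)  ≡⟨ cong reverse (sym (bar≡map u)) ⟩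
  reverse (bar u)        ∎

bar-rep : ∀ k x → bar (rep k x) ≡ rep k (swapL x)
bar-rep zero x = refl
bar-rep (suc k) x = cong (swapL x ∷_) (bar-rep k x)

rep-++-∷ : ∀ k x v → rep k x ++ x ∷ v ≡ x ∷ rep k x ++ v
rep-++-∷ zero x v = refl
rep-++-∷ (suc k) x v = cong (x ∷_) (rep-++-∷ k x v)

rep-∷ʳ : ∀ k x → rep k x ++ x ∷ [] ≡ x ∷ rep k x
rep-∷ʳ k x = trans (rep-++-∷ k x []) (cong (x ∷_) (++-identityʳ (rep k x)))

conj : Word → Word
conj u = reverse (bar u)

conj-involutive : ∀ u → conj (conj u) ≡ u
conj-involutive u = begin
  reverse (bar (reverse (bar u)))  ≡⟨ cong reverse (bar-reverse (bar u)) ⟩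
  reverse (reverse (bar (bar u)))  ≡⟨ reverse-involutive (bar (bar u)) ⟩
  bar (bar u)                      ≡⟨ bar-involutive u ⟩
  u                                ∎

conj-injective : ∀ {u v} → conj u ≡ conj v → u ≡ v
conj-injective {u} {v} e = trans (sym (conj-involutive u)) (trans (cong conj e) (conj-involutive v))

conj-++ : ∀ u v → conj (u ++ v) ≡ conj v ++ conj u
conj-++ u v = trans (cong reverse (bar-++ u v)) (reverse-++ (bar u) (bar v))

conj-concatMap : ∀ {g h : Letter → Word} → (∀ x → conj (g x) ≡ h (swapL x)) →
                 ∀ u → conj (concatMap g u) ≡ concatMap h (conj u)
conj-concatMap gh [] = refl
conj-concatMap {g} {h} gh (x ∷ u) = begin
  conj (g x ++ concatMap g u)                    ≡⟨ conj-++ (g x) (concatMap g u) ⟩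
  conj (concatMap g u) ++ conj (g x)             ≡⟨ cong₂ _++_ (conj-concatMap gh u) (gh x) ⟩
  concatMap h (conj u) ++ h (swapL x)            ≡⟨ cong (concatMap h (conj u) ++_) (sym (++-identityʳ (h (swapL x)))) ⟩
  concatMap h (conj u) ++ concatMap h (swapL x ∷ [])  ≡⟨ sym (concatMap-++ h (conj u) (swapL x ∷ [])) ⟩
  concatMap h (conj u ++ swapL x ∷ [])           ≡⟨ cong (concatMap h) (sym (unfold-reverse (swapL x) (bar u))) ⟩
  concatMap h (conj (x ∷ u))                     ∎

φl-suc : ∀ k x → φl (suc k) x ≡ a ∷ φl k x
φl-suc k a = refl
φl-suc k b = refl

conj-φl : ∀ k x → conj (φl k x) ≡ φ̂l k (swapL x)
conj-φl zero a = refl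
conj-φl zero b = refl
conj-φl (suc k) x = begin
  conj (φl (suc k) x)           ≡⟨ cong conj (φl-suc k x) ⟩
  conj (a ∷ φl k x)             ≡⟨ conj-++ (a ∷ []) (φl k x) ⟩
  conj (φl k x) ++ b ∷ []       ≡⟨ cong (_++ b ∷ []) (conj-φl k x) ⟩
  φ̂l k (swapL x) ++ b ∷ []      ≡⟨ φ̂l-∷ʳb (swapL x) ⟩
  φ̂l (suc k) (swapL x)          ∎
  where
    φ̂l-∷ʳb : ∀ y → φ̂l k y ++ b ∷ [] ≡ φ̂l (suc k) y
    φ̂l-∷ʳb a = cong (a ∷_) (rep-∷ʳ k b)
    φ̂l-∷ʳb b = cong (a ∷_) (rep-∷ʳ (suc k) b)

conj-φ : ∀ k w → conj (φ k w) ≡ φ̂ k (conj w)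
conj-φ k = conj-concatMap (conj-φl k)

conj-φ̂ : ∀ k w → conj (φ̂ k w) ≡ φ k (conj w)
conj-φ̂ k = conj-concatMap λ x → begin
  conj (φ̂l k x)                        ≡⟨ cong (conj ∘ φ̂l k) (sym (swapL-involutive x)) ⟩
  conj (φ̂l k (swapL (swapL x)))        ≡⟨ cong conj (sym (conj-φl k (swapL x))) ⟩
  conj (conj (φl k (swapL x)))         ≡⟨ conj-involutive (φl k (swapL x)) ⟩
  φl k (swapL x)                       ∎

-- Palindromic closure

Palindrome : Word → Set
Palindrome w = reverse w ≡ w

==W-sound : ∀ u v → (u ==W v) ≡ true → u ≡ v
==W-sound [] [] _ = refl
==W-sound (a ∷ u) (a ∷ v) e = cong (a ∷_) (==W-sound u v e)
==W-sound (b ∷ u) (b ∷ v) e = cong (b ∷_) (==W-sound u v e)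
==W-sound [] (_ ∷ _) ()
==W-sound (_ ∷ _) [] ()
==W-sound (a ∷ u) (b ∷ v) ()
==W-sound (b ∷ u) (a ∷ v) ()

==W-refl : ∀ u → (u ==W u) ≡ true
==W-refl [] = refl
==W-refl (a ∷ u) = ==W-refl u
==W-refl (b ∷ u) = ==W-refl u

isPal-sound : ∀ z → isPal z ≡ true → Palindrome z
isPal-sound z = ==W-sound (reverse z) z

isPal-complete : ∀ z → Palindrome z → isPal z ≡ true
isPal-complete z p = subst (λ t → (t ==W z) ≡ true) (sym p) (==W-refl z)

reverse-wrap : ∀ (s q : Word) → reverse (s ++ q ++ reverse s) ≡ s ++ reverse q ++ reverse s
reverse-wrap s q = begin
  reverse (s ++ q ++ reverse s)                 ≡⟨ reverse-++ s (q ++ reverse s) ⟩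
  reverse (q ++ reverse s) ++ reverse s         ≡⟨ cong (_++ reverse s) (reverse-++ q (reverse s)) ⟩
  (reverse (reverse s) ++ reverse q) ++ reverse s  ≡⟨ cong (λ t → (t ++ reverse q) ++ reverse s) (reverse-involutive s) ⟩
  (s ++ reverse q) ++ reverse s                 ≡⟨ ++-assoc s (reverse q) (reverse s) ⟩
  s ++ reverse q ++ reverse s                   ∎

palindrome-wrap : ∀ (s : Word) {q} → Palindrome q → Palindrome (s ++ q ++ reverse s)
palindrome-wrap s {q} p = trans (reverse-wrap s q) (cong (λ t → s ++ t ++ reverse s) p)

palindrome-unwrap : ∀ (s : Word) {q} → Palindrome (s ++ q ++ reverse s) → Palindrome q
palindrome-unwrap s {q} p = ++-cancelʳ (reverse s) (reverse q) q
  (++-cancelˡ s (reverse q ++ reverse s) (q ++ reverse s) (trans (sym (reverse-wrap s q)) p))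

palindromicSuffix-head : ∀ w x s y r → w ++ x ∷ [] ≡ s ++ y ∷ r → Palindrome (y ∷ r) → y ≡ x
palindromicSuffix-head w x s y r e p = sym (proj₁ (∷-injective (begin
  x ∷ reverse w            ≡⟨ sym (reverse-++ w (x ∷ [])) ⟩
  reverse (w ++ x ∷ [])    ≡⟨ cong reverse e ⟩
  reverse (s ++ y ∷ r)     ≡⟨ reverse-++ s (y ∷ r) ⟩
  reverse (y ∷ r) ++ reverse s  ≡⟨ cong (_++ reverse s) p ⟩
  y ∷ r ++ reverse s       ∎)))

PalSuffixesFrom : Word → ℕ → Set
PalSuffixesFrom z j = ∀ s q → z ≡ s ++ q → Palindrome q → j ≤ length s

record LongestPalSuffix (z s q : Word) : Set where
  constructor longest
  field
    split : z ≡ s ++ q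
    palindrome : Palindrome q
    shortestPrefix : PalSuffixesFrom z (length s)
open LongestPalSuffix public

take-length-++ : ∀ (s q : Word) → take (length s) (s ++ q) ≡ s
take-length-++ [] q = refl
take-length-++ (x ∷ s) q = cong (x ∷_) (take-length-++ s q)

closeAt-split : ∀ {z s q} → z ≡ s ++ q → z ++ reverse (take (length s) z) ≡ s ++ q ++ reverse s
closeAt-split {z} {s} {q} e = begin
  z ++ reverse (take (length s) z)                  ≡⟨ cong (λ t → t ++ reverse (take (length s) t)) e ⟩
  (s ++ q) ++ reverse (take (length s) (s ++ q))    ≡⟨ cong (λ t → (s ++ q) ++ reverse t) (take-length-++ s q) ⟩
  (s ++ q) ++ reverse s                             ≡⟨ ++-assoc s q (reverse s) ⟩
  s ++ q ++ reverse s                               ∎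

plusGo-correct : ∀ z j fuel → length z < j + fuel → PalSuffixesFrom z j →
  ∃₂ λ s q → LongestPalSuffix z s q × plusGo z j fuel ≡ s ++ q ++ reverse s
plusGo-correct z j zero bound from =
  ⊥-elim (<⇒≱ (subst (length z <_) (+-identityʳ j) bound) (from z [] (sym (++-identityʳ z)) refl))
plusGo-correct z j (suc fuel) bound from with isPal (z ++ reverse (take j z)) in found
... | true = take j z , drop j z ,
        longest (sym (take++drop≡id j z)) (palindrome-unwrap (take j z) (subst Palindrome cut (isPal-sound _ found)))
          (λ s q e p → ≤-trans (≤-trans (≤-reflexive (length-take j z)) (m⊓n≤m j (length z))) (from s q e p)) ,
        cut
  where
    cut : z ++ reverse (take j z) ≡ take j z ++ drop j z ++ reverse (take j z)
    cut = trans (cong (_++ reverse (take j z)) (sym (take++drop≡id j z))) (++-assoc (take j z) (drop j z) _)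
... | false = plusGo-correct z (suc j) fuel (subst (length z <_) (+-suc j fuel) bound) from′
  where
    from′ : PalSuffixesFrom z (suc j)
    from′ s q e p with m≤n⇒m<n∨m≡n (from s q e p)
    ... | inj₁ j<s = j<s
    ... | inj₂ refl with () ← trans (sym found)
                                (trans (cong isPal (closeAt-split {q = q} e)) (isPal-complete _ (palindrome-wrap s p)))

pclos-correct : ∀ z → ∃₂ λ s q → LongestPalSuffix z s q × pclos z ≡ s ++ q ++ reverse s
pclos-correct z = plusGo-correct z 0 (suc (length z)) ≤-refl (λ _ _ _ _ → z≤n)

longestPalSuffix-unique : ∀ {z s₁ q₁ s₂ q₂} → LongestPalSuffix z s₁ q₁ → LongestPalSuffix z s₂ q₂ →
                          s₁ ≡ s₂ × q₁ ≡ q₂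
longestPalSuffix-unique {s₁ = s₁} {q₁} {s₂} {q₂} L₁ L₂ =
  s₁≡s₂ , ++-cancelˡ s₂ q₁ q₂ (trans (cong (_++ q₁) (sym s₁≡s₂)) e)
  where
    e : s₁ ++ q₁ ≡ s₂ ++ q₂
    e = trans (sym (split L₁)) (split L₂)
    sameLength : length s₁ ≡ length s₂
    sameLength = ≤-antisym (shortestPrefix L₁ s₂ q₂ (split L₂) (palindrome L₂))
                           (shortestPrefix L₂ s₁ q₁ (split L₁) (palindrome L₁))
    s₁≡s₂ : s₁ ≡ s₂
    s₁≡s₂ = trans (sym (take-length-++ s₁ q₁)) (trans (cong₂ take sameLength e) (take-length-++ s₂ q₂))

pclos-longest : ∀ {z s q} → LongestPalSuffix z s q → pclos z ≡ s ++ q ++ reverse s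
pclos-longest {z} L with pclos-correct z
... | _ , _ , L′ , e with refl , refl ← longestPalSuffix-unique L L′ = e

pclos-palindrome : ∀ z → Palindrome (pclos z)
pclos-palindrome z with pclos-correct z
... | s , _ , L , e = subst Palindrome (sym e) (palindrome-wrap s (palindrome L))

pclos-extends : ∀ z → ∃ λ r → pclos z ≡ z ++ r
pclos-extends z with pclos-correct z
... | s , q , L , e = reverse s , trans e (trans (sym (++-assoc s q (reverse s))) (cong (_++ reverse s) (sym (split L))))

length-bar : ∀ u → length (bar u) ≡ length u
length-bar u = trans (cong length (bar≡map u)) (length-map swapL u)

palindrome-bar : ∀ {q} → Palindrome q → Palindrome (bar q)
palindrome-bar {q} p = trans (sym (bar-reverse q)) (cong bar p)

longestPalSuffix-bar : ∀ {z s q} → LongestPalSuffix z s q → LongestPalSuffix (bar z) (bar s) (bar q)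
longestPalSuffix-bar {z} {s} {q} L =
  longest (trans (cong bar (split L)) (bar-++ s q)) (palindrome-bar (palindrome L)) shortest
  where
    shortest : PalSuffixesFrom (bar z) (length (bar s))
    shortest s′ q′ e p = subst₂ _≤_ (sym (length-bar s)) (length-bar s′)
      (shortestPrefix L (bar s′) (bar q′) (trans (sym (bar-involutive z)) (trans (cong bar e) (bar-++ s′ q′)))
        (palindrome-bar p))

pclos-bar : ∀ z → pclos (bar z) ≡ bar (pclos z)
pclos-bar z with pclos-correct z
... | s , q , L , e = begin
  pclos (bar z)                          ≡⟨ pclos-longest (longestPalSuffix-bar L) ⟩
  bar s ++ bar q ++ reverse (bar s)      ≡⟨ cong (λ t → bar s ++ bar q ++ t) (sym (bar-reverse s)) ⟩
  bar s ++ bar q ++ bar (reverse s)      ≡⟨ cong (bar s ++_) (sym (bar-++ q (reverse s))) ⟩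
  bar s ++ bar (q ++ reverse s)          ≡⟨ sym (bar-++ s (q ++ reverse s)) ⟩
  bar (s ++ q ++ reverse s)              ≡⟨ cong bar (sym e) ⟩
  bar (pclos z)                          ∎

psiAcc-bar : ∀ acc u → psiAcc (bar acc) (bar u) ≡ bar (psiAcc acc u)
psiAcc-bar acc [] = refl
psiAcc-bar acc (x ∷ u) = trans
  (cong (λ t → psiAcc t (bar u)) (trans (cong pclos (sym (bar-++ acc (x ∷ [])))) (pclos-bar (acc ++ x ∷ []))))
  (psiAcc-bar (pclos (acc ++ x ∷ [])) u)

psi-bar : ∀ u → psi (bar u) ≡ bar (psi u)
psi-bar = psiAcc-bar []

psiAcc-palindrome : ∀ {acc} u → Palindrome acc → Palindrome (psiAcc acc u)
psiAcc-palindrome [] p = p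
psiAcc-palindrome {acc} (x ∷ u) _ = psiAcc-palindrome u (pclos-palindrome (acc ++ x ∷ []))

psi-palindrome : ∀ u → Palindrome (psi u)
psi-palindrome u = psiAcc-palindrome u refl

psiAcc-extends : ∀ acc u → ∃ λ r → psiAcc acc u ≡ acc ++ r
psiAcc-extends acc [] = [] , sym (++-identityʳ acc)
psiAcc-extends acc (x ∷ u) with pclos-extends (acc ++ x ∷ []) | psiAcc-extends (pclos (acc ++ x ∷ [])) u
... | r₁ , e₁ | r₂ , e₂ = x ∷ r₁ ++ r₂ , (begin
  psiAcc (pclos (acc ++ x ∷ [])) u     ≡⟨ e₂ ⟩
  pclos (acc ++ x ∷ []) ++ r₂          ≡⟨ cong (_++ r₂) e₁ ⟩
  ((acc ++ x ∷ []) ++ r₁) ++ r₂        ≡⟨ ++-assoc (acc ++ x ∷ []) r₁ r₂ ⟩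
  (acc ++ x ∷ []) ++ r₁ ++ r₂          ≡⟨ ++-assoc acc (x ∷ []) (r₁ ++ r₂) ⟩
  acc ++ x ∷ r₁ ++ r₂                  ∎)

-- pclos (x ∷ []) computes to x ∷ [], so psi (x ∷ u) is psiAcc (x ∷ []) u.
psi-∷ : ∀ x u → ∃ λ t → psi (x ∷ u) ≡ x ∷ t
psi-∷ a = psiAcc-extends (a ∷ [])
psi-∷ b = psiAcc-extends (b ∷ [])

-- Justin's formula

μaˡ : Letter → Word
μaˡ a = a ∷ []
μaˡ b = a ∷ b ∷ []

μa : Word → Word
μa = concatMap μaˡ

μa⁺ : Word → Word
μa⁺ t = μa t ++ a ∷ []

μa-++ : ∀ u v → μa (u ++ v) ≡ μa u ++ μa v
μa-++ = concatMap-++ μaˡ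

reverse-concatMap : ∀ (g : Letter → Word) u → reverse (concatMap g u) ≡ concatMap (reverse ∘ g) (reverse u)
reverse-concatMap g [] = refl
reverse-concatMap g (x ∷ u) = begin
  reverse (g x ++ concatMap g u)                          ≡⟨ reverse-++ (g x) (concatMap g u) ⟩
  reverse (concatMap g u) ++ reverse (g x)                ≡⟨ cong₂ _++_ (reverse-concatMap g u) (sym (++-identityʳ _)) ⟩
  concatMap h (reverse u) ++ concatMap h (x ∷ [])         ≡⟨ sym (concatMap-++ h (reverse u) (x ∷ [])) ⟩
  concatMap h (reverse u ++ x ∷ [])                       ≡⟨ cong (concatMap h) (sym (unfold-reverse x u)) ⟩
  concatMap h (reverse (x ∷ u))                           ∎
  where h = reverse ∘ g

reverse-μa⁺ : ∀ t → reverse (μa⁺ t) ≡ μa⁺ (reverse t)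
reverse-μa⁺ t = trans (reverse-++ (μa t) (a ∷ []))
                      (trans (cong (a ∷_) (reverse-concatMap μaˡ t)) (conjugate (reverse t)))
  where
    conjugate : ∀ r → a ∷ concatMap (reverse ∘ μaˡ) r ≡ μa⁺ r
    conjugate [] = refl
    conjugate (a ∷ r) = cong (a ∷_) (conjugate r)
    conjugate (b ∷ r) = cong (λ t → a ∷ b ∷ t) (conjugate r)

μa-injective : ∀ {x y} → μa x ≡ μa y → x ≡ y
μa-injective {[]} {[]} _ = refl
μa-injective {a ∷ x} {a ∷ y} e = cong (a ∷_) (μa-injective (∷-injectiveʳ e))
μa-injective {b ∷ x} {b ∷ y} e = cong (b ∷_) (μa-injective (∷-injectiveʳ (∷-injectiveʳ e)))
μa-injective {a ∷ x} {b ∷ y} e = ⊥-elim (μa-not-b x (∷-injectiveʳ e))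
  where
    μa-not-b : ∀ x {w} → μa x ≢ b ∷ w
    μa-not-b (a ∷ _) ()
    μa-not-b (b ∷ _) ()
μa-injective {b ∷ x} {a ∷ y} e = sym (μa-injective (sym e))
μa-injective {[]} {a ∷ y} ()
μa-injective {[]} {b ∷ y} ()
μa-injective {a ∷ x} {[]} ()
μa-injective {b ∷ x} {[]} ()

μa⁺-injective : ∀ {x y} → μa⁺ x ≡ μa⁺ y → x ≡ y
μa⁺-injective {x} {y} e = μa-injective (++-cancelʳ (a ∷ []) (μa x) (μa y) e)

palindrome-μa⁺ : ∀ {t} → Palindrome t → Palindrome (μa⁺ t)
palindrome-μa⁺ {t} p = trans (reverse-μa⁺ t) (cong μa⁺ p)

palindrome-μa⁺⁻¹ : ∀ {t} → Palindrome (μa⁺ t) → Palindrome t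
palindrome-μa⁺⁻¹ {t} p = μa⁺-injective (trans (sym (reverse-μa⁺ t)) p)

μa-∷ʳb : ∀ t → μa (t ++ b ∷ []) ≡ μa⁺ t ++ b ∷ []
μa-∷ʳb t = trans (μa-++ t (b ∷ [])) (sym (++-assoc (μa t) (a ∷ []) (b ∷ [])))

palindrome-b∷μa : ∀ {r} → Palindrome (b ∷ r) → Palindrome (b ∷ μa r)
palindrome-b∷μa {r} p with initLast r
... | [] = refl
... | t ∷ʳ′ c with refl ← palindromicSuffix-head (b ∷ t) c [] b (t ++ c ∷ []) refl p =
  subst Palindrome (sym (cong (b ∷_) (μa-∷ʳb t))) (palindrome-wrap (b ∷ []) (palindrome-μa⁺ (palindrome-unwrap (b ∷ []) p)))

palindrome-b∷μa⁻¹ : ∀ {r} → Palindrome (b ∷ μa r) → Palindrome (b ∷ r)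
palindrome-b∷μa⁻¹ {r} p with initLast r
... | [] = refl
... | t ∷ʳ′ a with () ← palindromicSuffix-head (b ∷ μa t) a [] b (μa (t ++ a ∷ []))
                         (cong (b ∷_) (sym (μa-++ t (a ∷ [])))) p
... | t ∷ʳ′ b = palindrome-wrap (b ∷ [])
  (palindrome-μa⁺⁻¹ (palindrome-unwrap (b ∷ []) (subst Palindrome (cong (b ∷_) (μa-∷ʳb t)) p)))

μa⁺-cut-a : ∀ Z S R → μa⁺ Z ≡ S ++ a ∷ R →
  ∃₂ λ Z₁ Z₂ → Z ≡ Z₁ ++ Z₂ × S ≡ μa Z₁ × a ∷ R ≡ μa⁺ Z₂
μa⁺-cut-a Z [] R e = [] , Z , refl , refl , sym e
μa⁺-cut-a [] (c ∷ S) R e with () ← ++-conicalʳ S (a ∷ R) (sym (∷-injectiveʳ e))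
μa⁺-cut-a (a ∷ Z) (c ∷ S) R e with refl , e′ ← ∷-injective e with μa⁺-cut-a Z S R e′
... | Z₁ , Z₂ , refl , refl , e″ = a ∷ Z₁ , Z₂ , refl , refl , e″
μa⁺-cut-a (b ∷ Z) (c ∷ []) R ()
μa⁺-cut-a (b ∷ Z) (c ∷ d ∷ S) R e with refl , e′ ← ∷-injective e with refl , e″ ← ∷-injective e′
  with μa⁺-cut-a Z S R e″
... | Z₁ , Z₂ , refl , refl , e‴ = b ∷ Z₁ , Z₂ , refl , refl , e‴

μa-cut-b : ∀ Z S R → μa Z ≡ S ++ b ∷ R →
  ∃₂ λ Z₁ Z₂ → Z ≡ Z₁ ++ b ∷ Z₂ × S ≡ μa⁺ Z₁ × R ≡ μa Z₂
μa-cut-b [] S R e with () ← ++-conicalʳ S (b ∷ R) (sym e)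
μa-cut-b (a ∷ Z) [] R ()
μa-cut-b (a ∷ Z) (c ∷ S) R e with refl , e′ ← ∷-injective e with μa-cut-b Z S R e′
... | Z₁ , Z₂ , refl , refl , refl = a ∷ Z₁ , Z₂ , refl , refl , refl
μa-cut-b (b ∷ Z) [] R ()
μa-cut-b (b ∷ Z) (c ∷ []) R e with refl , e′ ← ∷-injective e with refl , e″ ← ∷-injective e′ =
  [] , Z , refl , refl , sym e″
μa-cut-b (b ∷ Z) (c ∷ d ∷ S) R e with refl , e′ ← ∷-injective e with refl , e″ ← ∷-injective e′
  with μa-cut-b Z S R e″
... | Z₁ , Z₂ , refl , refl , refl = b ∷ Z₁ , Z₂ , refl , refl , refl

prefix-of-longer : ∀ (s q u v : Word) → s ++ q ≡ u ++ v → length s ≤ length u → ∃ λ m → u ≡ s ++ m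
prefix-of-longer [] q u v e _ = u , refl
prefix-of-longer (x ∷ s) q (y ∷ u) v e (s≤s le) with refl , e′ ← ∷-injective e
  with prefix-of-longer s q u v e′ le
... | m , refl = m , refl

μa-mono : ∀ {Z q Z₂ : Word} (s Z₁ : Word) → Z ≡ s ++ q → Z ≡ Z₁ ++ Z₂ →
          length s ≤ length Z₁ → length (μa s) ≤ length (μa Z₁)
μa-mono {q = q} {Z₂} s Z₁ e₁ e₂ le with prefix-of-longer s q Z₁ Z₂ (trans (sym e₁) e₂) le
... | m , refl = subst (λ t → length (μa s) ≤ length t) (sym (μa-++ s m)) (length-++-≤ˡ (μa s))

prefix-≤-whole : ∀ {z : Word} (s q S : Word) → z ≡ s ++ q → z ≡ S ++ [] → length s ≤ length S
prefix-≤-whole s q S e₁ e₂ =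
  subst (λ t → length s ≤ length t) (trans (sym e₁) (trans e₂ (++-identityʳ S))) (length-++-≤ˡ s)

-- A nonempty palindromic suffix of μa⁺ Z begins with a, so it is cut out by
-- μa⁺-cut-a and comes from a palindromic suffix of Z; for μa Z (ending in b)
-- the same works with μa-cut-b.
longestPalSuffix-μa⁺ : ∀ {Z s q} → LongestPalSuffix Z s q → LongestPalSuffix (μa⁺ Z) (μa s) (μa⁺ q)
longestPalSuffix-μa⁺ {Z} {s} {q} L = longest split′ (palindrome-μa⁺ (palindrome L)) shortest
  where
    split′ : μa⁺ Z ≡ μa s ++ μa⁺ q
    split′ = trans (cong μa⁺ (split L)) (trans (cong (_++ a ∷ []) (μa-++ s q)) (++-assoc (μa s) (μa q) (a ∷ [])))
    shortest : PalSuffixesFrom (μa⁺ Z) (length (μa s))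
    shortest S [] e p = prefix-≤-whole (μa s) (μa⁺ q) S split′ e
    shortest S (c ∷ R) e p with refl ← palindromicSuffix-head (μa Z) a S c R e p with μa⁺-cut-a Z S R e
    ... | Z₁ , Z₂ , Z≡ , refl , e′ =
      μa-mono s Z₁ (split L) Z≡ (shortestPrefix L Z₁ Z₂ Z≡ (palindrome-μa⁺⁻¹ (subst Palindrome e′ p)))

longestPalSuffix-μa : ∀ {Z s r} → LongestPalSuffix Z s (b ∷ r) → LongestPalSuffix (μa Z) (μa⁺ s) (b ∷ μa r)
longestPalSuffix-μa {Z} {s} {r} L = longest split′ pal shortest
  where
    split′ : μa Z ≡ μa⁺ s ++ b ∷ μa r
    split′ = trans (cong μa (split L)) (trans (μa-++ s (b ∷ r)) (sym (++-assoc (μa s) (a ∷ []) (b ∷ μa r))))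
    pal : Palindrome (b ∷ μa r)
    pal = palindrome-b∷μa (palindrome L)
    endsWith-b : μa Z ≡ (μa⁺ s ++ reverse (μa r)) ++ b ∷ []
    endsWith-b = begin
      μa Z                                    ≡⟨ split′ ⟩
      μa⁺ s ++ b ∷ μa r                       ≡⟨ cong (μa⁺ s ++_) (sym (trans (sym (unfold-reverse b (μa r))) pal)) ⟩
      μa⁺ s ++ reverse (μa r) ++ b ∷ []       ≡⟨ sym (++-assoc (μa⁺ s) (reverse (μa r)) (b ∷ [])) ⟩
      (μa⁺ s ++ reverse (μa r)) ++ b ∷ []     ∎
    shortest : PalSuffixesFrom (μa Z) (length (μa⁺ s))
    shortest S [] e p = prefix-≤-whole (μa⁺ s) (b ∷ μa r) S split′ e
    shortest S (c ∷ R) e p with refl ← palindromicSuffix-head _ b S c R (trans (sym endsWith-b) e) p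
      with μa-cut-b Z S R e
    ... | Z₁ , Z₂ , Z≡ , refl , refl = subst₂ _≤_ (sym (length-++ (μa s))) (sym (length-++ (μa Z₁)))
      (+-monoˡ-≤ 1 (μa-mono s Z₁ (split L) Z≡ (shortestPrefix L Z₁ (b ∷ Z₂) Z≡ (palindrome-b∷μa⁻¹ p))))

μa⁺-wrap : ∀ s m → μa⁺ (s ++ m ++ reverse s) ≡ μa s ++ μa⁺ m ++ reverse (μa s)
μa⁺-wrap s m = begin
  μa (s ++ m ++ reverse s) ++ a ∷ []
    ≡⟨ cong (_++ a ∷ []) (trans (μa-++ s (m ++ reverse s)) (cong (μa s ++_) (μa-++ m (reverse s)))) ⟩
  (μa s ++ μa m ++ μa (reverse s)) ++ a ∷ []
    ≡⟨ trans (++-assoc (μa s) _ _) (cong (μa s ++_) (++-assoc (μa m) _ _)) ⟩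
  μa s ++ μa m ++ μa⁺ (reverse s)
    ≡⟨ cong (λ t → μa s ++ μa m ++ t) (trans (sym (reverse-μa⁺ s)) (reverse-++ (μa s) (a ∷ []))) ⟩
  μa s ++ μa m ++ a ∷ reverse (μa s)
    ≡⟨ cong (μa s ++_) (sym (++-assoc (μa m) (a ∷ []) (reverse (μa s)))) ⟩
  μa s ++ μa⁺ m ++ reverse (μa s)
    ∎

pclos-μa⁺-∷ʳ : ∀ w y → pclos (μa⁺ w ++ y ∷ []) ≡ μa⁺ (pclos (w ++ y ∷ []))
pclos-μa⁺-∷ʳ w a with pclos-correct (w ++ a ∷ [])
... | s , q , L , e = begin
  pclos (μa⁺ w ++ a ∷ [])                   ≡⟨ cong (λ t → pclos (t ++ a ∷ [])) (sym (μa-++ w (a ∷ []))) ⟩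
  pclos (μa⁺ (w ++ a ∷ []))                 ≡⟨ pclos-longest (longestPalSuffix-μa⁺ L) ⟩
  μa s ++ μa⁺ q ++ reverse (μa s)           ≡⟨ sym (μa⁺-wrap s q) ⟩
  μa⁺ (s ++ q ++ reverse s)                 ≡⟨ cong μa⁺ (sym e) ⟩
  μa⁺ (pclos (w ++ a ∷ []))                 ∎
pclos-μa⁺-∷ʳ w b with pclos-correct (w ++ b ∷ [])
... | s , [] , L , _ = ⊥-elim (<⇒≱ longer (shortestPrefix L w (b ∷ []) refl refl))
  where
    longer : length w < length s
    longer = subst₂ _≤_ (trans (length-++ w) (+-comm (length w) 1)) (cong length (trans (split L) (++-identityʳ s))) ≤-refl
... | s , c ∷ r , L , e with refl ← palindromicSuffix-head w b s c r (split L) (palindrome L) = begin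
  pclos (μa⁺ w ++ b ∷ [])                            ≡⟨ cong pclos (sym (μa-∷ʳb w)) ⟩
  pclos (μa (w ++ b ∷ []))                           ≡⟨ pclos-longest (longestPalSuffix-μa L) ⟩
  μa⁺ s ++ (b ∷ μa r) ++ reverse (μa⁺ s)
    ≡⟨ cong (λ t → μa⁺ s ++ (b ∷ μa r) ++ t) (reverse-++ (μa s) (a ∷ [])) ⟩
  (μa s ++ a ∷ []) ++ (b ∷ μa r) ++ a ∷ reverse (μa s)
    ≡⟨ ++-assoc (μa s) (a ∷ []) _ ⟩
  μa s ++ a ∷ b ∷ μa r ++ a ∷ reverse (μa s)
    ≡⟨ cong (λ t → μa s ++ a ∷ b ∷ t) (sym (++-assoc (μa r) (a ∷ []) (reverse (μa s)))) ⟩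
  μa s ++ μa⁺ (b ∷ r) ++ reverse (μa s)              ≡⟨ sym (μa⁺-wrap s (b ∷ r)) ⟩
  μa⁺ (s ++ (b ∷ r) ++ reverse s)                    ≡⟨ cong μa⁺ (sym e) ⟩
  μa⁺ (pclos (w ++ b ∷ []))                          ∎

psiAcc-μa⁺ : ∀ acc u → psiAcc (μa⁺ acc) u ≡ μa⁺ (psiAcc acc u)
psiAcc-μa⁺ acc [] = refl
psiAcc-μa⁺ acc (y ∷ u) =
  trans (cong (λ t → psiAcc t u) (pclos-μa⁺-∷ʳ acc y)) (psiAcc-μa⁺ (pclos (acc ++ y ∷ [])) u)

justin-a : ∀ u → psi (a ∷ u) ≡ μa⁺ (psi u)
justin-a = psiAcc-μa⁺ []

-- Christoffel words as morphic images

μa-φl : ∀ k x → μa (φl k x) ≡ φl (suc k) x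
μa-φl zero a = refl
μa-φl zero b = refl
μa-φl (suc k) x = begin
  μa (φl (suc k) x)          ≡⟨ cong μa (φl-suc k x) ⟩
  a ∷ μa (φl k x)            ≡⟨ cong (a ∷_) (μa-φl k x) ⟩
  a ∷ φl (suc k) x           ≡⟨ sym (φl-suc (suc k) x) ⟩
  φl (suc (suc k)) x         ∎

φ-suc : ∀ k w → φ (suc k) w ≡ μa (φ k w)
φ-suc k [] = refl
φ-suc k (x ∷ w) = trans (cong₂ _++_ (sym (μa-φl k x)) (φ-suc k w)) (sym (μa-++ (φl k x) (φ k w)))

conj-μa : ∀ w → conj (μa w) ≡ φ 0 (conj w)
conj-μa = conj-concatMap λ { a → refl ; b → refl }

φ-injective : ∀ k {x y} → φ k x ≡ φ k y → x ≡ y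
φ-injective zero {x} {y} e = conj-injective (μa-injective (conj-injective (begin
  conj (μa (conj x))     ≡⟨ conj-μa (conj x) ⟩
  φ 0 (conj (conj x))    ≡⟨ cong (φ 0) (conj-involutive x) ⟩
  φ 0 x                  ≡⟨ e ⟩
  φ 0 y                  ≡⟨ cong (φ 0) (sym (conj-involutive y)) ⟩
  φ 0 (conj (conj y))    ≡⟨ sym (conj-μa (conj y)) ⟩
  conj (μa (conj y))     ∎)))
φ-injective (suc k) {x} {y} e = φ-injective k (μa-injective (trans (sym (φ-suc k x)) (trans e (φ-suc k y))))

chr-a∷ : ∀ u → chr (a ∷ u) ≡ μa (chr u)
chr-a∷ u = cong (a ∷_) (begin
  psi (a ∷ u) ++ b ∷ []              ≡⟨ cong (_++ b ∷ []) (justin-a u) ⟩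
  (μa (psi u) ++ a ∷ []) ++ b ∷ []   ≡⟨ ++-assoc (μa (psi u)) (a ∷ []) (b ∷ []) ⟩
  μa (psi u) ++ μa (b ∷ [])          ≡⟨ sym (μa-++ (psi u) (b ∷ [])) ⟩
  μa (psi u ++ b ∷ [])               ∎)

chr-bar : ∀ u → chr (bar u) ≡ conj (chr u)
chr-bar u = begin
  a ∷ psi (bar u) ++ b ∷ []     ≡⟨ cong (λ t → a ∷ t ++ b ∷ []) (psi-bar u) ⟩
  a ∷ bar (psi u) ++ b ∷ []     ≡⟨ cong (λ t → a ∷ t ++ b ∷ []) (trans (cong bar (sym (psi-palindrome u))) (bar-reverse (psi u))) ⟩
  a ∷ conj (psi u) ++ b ∷ []    ≡⟨ cong (a ∷_) (sym (conj-++ (a ∷ []) (psi u))) ⟩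
  a ∷ conj (a ∷ psi u)          ≡⟨ sym (conj-++ (a ∷ psi u) (b ∷ [])) ⟩
  conj (chr u)                  ∎

chr-b∷ : ∀ u → chr (b ∷ u) ≡ φ 0 (chr u)
chr-b∷ u = begin
  chr (b ∷ u)                   ≡⟨ cong (λ t → chr (b ∷ t)) (sym (bar-involutive u)) ⟩
  chr (bar (a ∷ bar u))         ≡⟨ chr-bar (a ∷ bar u) ⟩
  conj (chr (a ∷ bar u))        ≡⟨ cong conj (chr-a∷ (bar u)) ⟩
  conj (μa (chr (bar u)))       ≡⟨ conj-μa (chr (bar u)) ⟩
  φ 0 (conj (chr (bar u)))      ≡⟨ cong (φ 0 ∘ conj) (chr-bar u) ⟩
  φ 0 (conj (conj (chr u)))     ≡⟨ cong (φ 0) (conj-involutive (chr u)) ⟩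
  φ 0 (chr u)                   ∎

chr-run : ∀ k → chr (a ∷ rep k a) ≡ φ (suc k) (a ∷ [])
chr-run zero = refl
chr-run (suc k) = trans (chr-a∷ (a ∷ rep k a)) (trans (cong μa (chr-run k)) (sym (φ-suc (suc k) (a ∷ []))))

chr-block : ∀ k w → chr (a ∷ rep k a ++ b ∷ w) ≡ φ (suc k) (chr w)
chr-block zero w = trans (chr-a∷ (b ∷ w)) (trans (cong μa (chr-b∷ w)) (sym (φ-suc 0 (chr w))))
chr-block (suc k) w =
  trans (chr-a∷ (a ∷ rep k a ++ b ∷ w)) (trans (cong μa (chr-block k w)) (sym (φ-suc (suc k) (chr w))))

chr-∷ : ∀ x u → ∃ λ t → chr (x ∷ u) ≡ a ∷ x ∷ t ++ b ∷ []
chr-∷ x u with psi-∷ x u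
... | t , e = t , cong (λ p → a ∷ p ++ b ∷ []) e

-- Derivatives

runFrom-bar : ∀ x u → runFrom (swapL x) (bar u) ≡ runFrom x u
runFrom-bar x [] = refl
runFrom-bar a (a ∷ u) = cong suc (runFrom-bar a u)
runFrom-bar a (b ∷ u) = refl
runFrom-bar b (a ∷ u) = refl
runFrom-bar b (b ∷ u) = cong suc (runFrom-bar b u)

index-bar : ∀ u → index (bar u) ≡ index u
index-bar [] = refl
index-bar (x ∷ u) = cong suc (runFrom-bar x u)

runFrom-a-run : ∀ k → runFrom a (rep k a) ≡ k
runFrom-a-run zero = refl
runFrom-a-run (suc k) = cong suc (runFrom-a-run k)

runFrom-a-block : ∀ k w → runFrom a (rep k a ++ b ∷ w) ≡ k
runFrom-a-block zero w = refl
runFrom-a-block (suc k) w = cong suc (runFrom-a-block k w)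

leadingAs : Word → ℕ
leadingAs [] = 0
leadingAs (a ∷ w) = suc (leadingAs w)
leadingAs (b ∷ w) = 0

leadingAs-μa : ∀ v ys → leadingAs (μa (v ++ b ∷ ys)) ≡ suc (leadingAs (v ++ b ∷ ys))
leadingAs-μa [] ys = refl
leadingAs-μa (a ∷ v) ys = cong suc (leadingAs-μa v ys)
leadingAs-μa (b ∷ v) ys = refl

leadingAs-chr : ∀ u → leadingAs (chr u) ≡ index (a ∷ u)
leadingAs-chr [] = refl
leadingAs-chr (a ∷ u) =
  trans (cong leadingAs (chr-a∷ u)) (trans (leadingAs-μa (a ∷ psi u) []) (cong suc (leadingAs-chr u)))
leadingAs-chr (b ∷ u) with chr-∷ b u
... | _ , e = cong leadingAs e

conj-derivation-a : ∀ u w → φ (index (a ∷ u)) w ≡ chr (a ∷ u) → φ̂ (index (b ∷ bar u)) (conj w) ≡ chr (b ∷ bar u)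
conj-derivation-a u w e = begin
  φ̂ (index (b ∷ bar u)) (conj w)     ≡⟨ cong (λ k → φ̂ k (conj w)) (index-bar (a ∷ u)) ⟩
  φ̂ (index (a ∷ u)) (conj w)         ≡⟨ sym (conj-φ (index (a ∷ u)) w) ⟩
  conj (φ (index (a ∷ u)) w)         ≡⟨ cong conj e ⟩
  conj (chr (a ∷ u))                 ≡⟨ sym (chr-bar (a ∷ u)) ⟩
  chr (b ∷ bar u)                    ∎

conj-derivation-b : ∀ u w → φ̂ (index (b ∷ u)) w ≡ chr (b ∷ u) → φ (index (a ∷ bar u)) (conj w) ≡ chr (a ∷ bar u)
conj-derivation-b u w e = begin
  φ (index (a ∷ bar u)) (conj w)     ≡⟨ cong (λ k → φ k (conj w)) (index-bar (b ∷ u)) ⟩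
  φ (index (b ∷ u)) (conj w)         ≡⟨ sym (conj-φ̂ (index (b ∷ u)) w) ⟩
  conj (φ̂ (index (b ∷ u)) w)         ≡⟨ cong conj e ⟩
  conj (chr (b ∷ u))                 ≡⟨ sym (chr-bar (b ∷ u)) ⟩
  chr (a ∷ bar u)                    ∎

derivation-a-unique : ∀ u₁ u₂ {w₁ w₂} →
  φ (index (a ∷ u₁)) w₁ ≡ chr (a ∷ u₁) → φ (index (a ∷ u₂)) w₂ ≡ chr (a ∷ u₂) →
  chr (a ∷ u₁) ≡ chr (a ∷ u₂) → w₁ ≡ w₂
derivation-a-unique u₁ u₂ {w₁} {w₂} e₁ e₂ e = φ-injective (index (a ∷ u₁)) (begin
  φ (index (a ∷ u₁)) w₁     ≡⟨ trans e₁ (trans e (sym e₂)) ⟩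
  φ (index (a ∷ u₂)) w₂     ≡⟨ cong (λ k → φ k w₂) (sym sameIndex) ⟩
  φ (index (a ∷ u₁)) w₂     ∎)
  where
    sameIndex : index (a ∷ u₁) ≡ index (a ∷ u₂)
    sameIndex = trans (sym (leadingAs-chr u₁))
      (trans (cong leadingAs (μa-injective (trans (sym (chr-a∷ u₁)) (trans e (chr-a∷ u₂))))) (leadingAs-chr u₂))

chr-[]≢chr-∷ : ∀ x u → chr [] ≢ chr (x ∷ u)
chr-[]≢chr-∷ x u e with chr-∷ x u
... | t , e′ with () ← ++-conicalʳ t (b ∷ []) (sym (∷-injectiveʳ (∷-injectiveʳ (trans e e′))))

chr-a≢chr-b : ∀ u₁ u₂ → chr (a ∷ u₁) ≢ chr (b ∷ u₂)
chr-a≢chr-b u₁ u₂ e with chr-∷ a u₁ | chr-∷ b u₂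
... | _ , e₁ | _ , e₂ with () ← ∷-injectiveˡ (∷-injectiveʳ (trans (sym e₁) (trans e e₂)))

Deriv-unique : ∀ {W₁ W₂ w₁ w₂} → Deriv W₁ w₁ → Deriv W₂ w₂ → W₁ ≡ W₂ → w₁ ≡ w₂
Deriv-unique d-ab d-ab _ = refl
Deriv-unique d-ab (d-a u _ _) e = ⊥-elim (chr-[]≢chr-∷ a u e)
Deriv-unique d-ab (d-b u _ _) e = ⊥-elim (chr-[]≢chr-∷ b u e)
Deriv-unique (d-a u _ _) d-ab e = ⊥-elim (chr-[]≢chr-∷ a u (sym e))
Deriv-unique (d-b u _ _) d-ab e = ⊥-elim (chr-[]≢chr-∷ b u (sym e))
Deriv-unique (d-a u₁ _ _) (d-b u₂ _ _) e = ⊥-elim (chr-a≢chr-b u₁ u₂ e)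
Deriv-unique (d-b u₁ _ _) (d-a u₂ _ _) e = ⊥-elim (chr-a≢chr-b u₂ u₁ (sym e))
Deriv-unique (d-a u₁ _ e₁) (d-a u₂ _ e₂) e = derivation-a-unique u₁ u₂ e₁ e₂ e
Deriv-unique (d-b u₁ w₁ e₁) (d-b u₂ w₂ e₂) e = conj-injective
  (derivation-a-unique (bar u₁) (bar u₂) (conj-derivation-b u₁ w₁ e₁) (conj-derivation-b u₂ w₂ e₂)
    (trans (chr-bar (b ∷ u₁)) (trans (cong conj e) (sym (chr-bar (b ∷ u₂))))))

chr≢letter : ∀ u x → chr u ≢ x ∷ []
chr≢letter u x e with () ← ++-conicalʳ (psi u) (b ∷ []) (∷-injectiveʳ e)

Deriv-not-from-letter : ∀ {W w x} → Deriv W w → W ≢ x ∷ []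
Deriv-not-from-letter d-ab ()
Deriv-not-from-letter (d-a u _ _) = chr≢letter (a ∷ u) _
Deriv-not-from-letter (d-b u _ _) = chr≢letter (b ∷ u) _

Iter-to-letter-unique : ∀ {m n W₁ W₂ l₁ l₂} → Iter m W₁ l₁ → IsLetter l₁ → Iter n W₂ l₂ → IsLetter l₂ →
                        W₁ ≡ W₂ → m ≡ n
Iter-to-letter-unique it0 _ it0 _ _ = refl
Iter-to-letter-unique it0 (isLetter x) (itS d _) _ e = ⊥-elim (Deriv-not-from-letter d (sym e))
Iter-to-letter-unique (itS d _) _ it0 (isLetter x) e = ⊥-elim (Deriv-not-from-letter d e)
Iter-to-letter-unique (itS d₁ it₁) l₁ (itS d₂ it₂) l₂ e =
  cong suc (Iter-to-letter-unique it₁ l₁ it₂ l₂ (Deriv-unique d₁ d₂ e))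

LetterAfter : ℕ → Word → Set
LetterAfter n W = Σ Word λ l → Iter n W l × IsLetter l

hasDepth : ∀ {d W} → LetterAfter d W → HasDepth W d
hasDepth reach@(_ , it , isL) = reach , λ d′ w′ it′ isL′ → ≤-reflexive (Iter-to-letter-unique it isL it′ isL′ refl)

Iter-conj : ∀ {n W l} → Iter n W l → IsLetter l → LetterAfter n (conj W)
Iter-conj it0 (isLetter x) = swapL x ∷ [] , it0 , isLetter (swapL x)
Iter-conj (itS d-ab it) isL = _ , itS d-ab it , isL
Iter-conj (itS (d-a u w e) it) isL with Iter-conj it isL
... | l , it′ , isL′ =
  l , itS (subst (λ W → Deriv W (conj w)) (chr-bar (a ∷ u)) (d-b (bar u) (conj w) (conj-derivation-a u w e))) it′ , isL′
Iter-conj (itS (d-b u w e) it) isL with Iter-conj it isL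
... | l , it′ , isL′ =
  l , itS (subst (λ W → Deriv W (conj w)) (chr-bar (b ∷ u)) (d-a (bar u) (conj w) (conj-derivation-b u w e))) it′ , isL′

letterAfter-bar : ∀ {n} u → LetterAfter n (chr u) → LetterAfter n (chr (bar u))
letterAfter-bar {n} u (_ , it , isL) = subst (LetterAfter n) (sym (chr-bar u)) (Iter-conj it isL)

-- The depth

reverse-∷-∷ : ∀ {A : Set} (x y : A) r → reverse (x ∷ y ∷ r) ≡ reverse r ++ y ∷ x ∷ []
reverse-∷-∷ x y r =
  trans (unfold-reverse x (y ∷ r)) (trans (cong (_++ x ∷ []) (unfold-reverse y r)) (++-assoc (reverse r) (y ∷ []) (x ∷ [])))

changes : Word → List Bool
changes [] = []
changes (x ∷ []) = []
changes (x ∷ y ∷ r) = not (x ==L y) ∷ changes (y ∷ r)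

-- A derivative step strips the first run of u together with the letter after
-- it, i.e. a `true` of changes u together with the entry following it.
stepCount : List Bool → ℕ
stepCount [] = 0
stepCount (false ∷ r) = stepCount r
stepCount (true ∷ []) = 1
stepCount (true ∷ _ ∷ r) = suc (stepCount r)

depthOf : Word → ℕ
depthOf u = suc (stepCount (changes u))

==L-sym : ∀ x y → (x ==L y) ≡ (y ==L x)
==L-sym a a = refl
==L-sym a b = refl
==L-sym b a = refl
==L-sym b b = refl

changes-∷ʳ : ∀ xs y z → changes (xs ++ y ∷ z ∷ []) ≡ changes (xs ++ y ∷ []) ++ not (y ==L z) ∷ []
changes-∷ʳ [] y z = refl
changes-∷ʳ (x ∷ []) y z = refl
changes-∷ʳ (x ∷ x′ ∷ xs) y z = cong (not (x ==L x′) ∷_) (changes-∷ʳ (x′ ∷ xs) y z)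

changes-reverse : ∀ v → changes (reverse v) ≡ reverse (changes v)
changes-reverse [] = refl
changes-reverse (x ∷ []) = refl
changes-reverse (x ∷ y ∷ r) = begin
  changes (reverse (x ∷ y ∷ r))
    ≡⟨ cong changes (reverse-∷-∷ x y r) ⟩
  changes (reverse r ++ y ∷ x ∷ [])
    ≡⟨ changes-∷ʳ (reverse r) y x ⟩
  changes (reverse r ++ y ∷ []) ++ not (y ==L x) ∷ []
    ≡⟨ cong (λ t → changes t ++ not (y ==L x) ∷ []) (sym (unfold-reverse y r)) ⟩
  changes (reverse (y ∷ r)) ++ not (y ==L x) ∷ []
    ≡⟨ cong₂ (λ s t → s ++ not t ∷ []) (changes-reverse (y ∷ r)) (==L-sym y x) ⟩
  reverse (changes (y ∷ r)) ++ not (x ==L y) ∷ []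
    ≡⟨ sym (unfold-reverse (not (x ==L y)) (changes (y ∷ r))) ⟩
  reverse (changes (x ∷ y ∷ r))
    ∎

stepCount-∷ʳfalse : ∀ r → stepCount (r ++ false ∷ []) ≡ stepCount r
stepCount-∷ʳfalse [] = refl
stepCount-∷ʳfalse (false ∷ r) = stepCount-∷ʳfalse r
stepCount-∷ʳfalse (true ∷ []) = refl
stepCount-∷ʳfalse (true ∷ _ ∷ r) = cong suc (stepCount-∷ʳfalse r)

stepCount-∷ʳtrue : ∀ r x → stepCount (r ++ x ∷ true ∷ []) ≡ suc (stepCount r)
stepCount-∷ʳtrue [] false = refl
stepCount-∷ʳtrue [] true = refl
stepCount-∷ʳtrue (false ∷ r) x = stepCount-∷ʳtrue r x
stepCount-∷ʳtrue (true ∷ []) x = refl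
stepCount-∷ʳtrue (true ∷ _ ∷ r) x = cong suc (stepCount-∷ʳtrue r x)

stepCount-reverse : ∀ e → stepCount (reverse e) ≡ stepCount e
stepCount-reverse [] = refl
stepCount-reverse (false ∷ r) = trans (cong stepCount (unfold-reverse false r))
                                      (trans (stepCount-∷ʳfalse (reverse r)) (stepCount-reverse r))
stepCount-reverse (true ∷ []) = refl
stepCount-reverse (true ∷ y ∷ r) = begin
  stepCount (reverse (true ∷ y ∷ r))           ≡⟨ cong stepCount (reverse-∷-∷ true y r) ⟩
  stepCount (reverse r ++ y ∷ true ∷ [])       ≡⟨ stepCount-∷ʳtrue (reverse r) y ⟩
  suc (stepCount (reverse r))                  ≡⟨ cong suc (stepCount-reverse r) ⟩
  suc (stepCount r)                            ∎

depthOf-reverse : ∀ v → depthOf (reverse v) ≡ depthOf v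
depthOf-reverse v = cong suc (trans (cong stepCount (changes-reverse v)) (stepCount-reverse (changes v)))

stepCount-changes-rep : ∀ x k v → stepCount (changes (x ∷ rep k x ++ v)) ≡ stepCount (changes (x ∷ v))
stepCount-changes-rep x zero v = refl
stepCount-changes-rep a (suc k) v = stepCount-changes-rep a k v
stepCount-changes-rep b (suc k) v = stepCount-changes-rep b k v

depthOf-run : ∀ x k → depthOf (x ∷ rep k x) ≡ 1
depthOf-run x k = cong suc (trans (cong (λ t → stepCount (changes (x ∷ t))) (sym (++-identityʳ (rep k x))))
                                  (stepCount-changes-rep x k []))

depthOf-block : ∀ x k w → depthOf (x ∷ rep k x ++ swapL x ∷ w) ≡ suc (depthOf w)
depthOf-block x k w = cong suc (trans (stepCount-changes-rep x k (swapL x ∷ w)) (afterChange x w))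
  where
    afterChange : ∀ x w → stepCount (changes (x ∷ swapL x ∷ w)) ≡ depthOf w
    afterChange a [] = refl
    afterChange a (_ ∷ _) = refl
    afterChange b [] = refl
    afterChange b (_ ∷ _) = refl

data Blocks : Word → Set where
  empty : Blocks []
  run : ∀ x k → Blocks (x ∷ rep k x)
  block : ∀ x k {w} → Blocks w → Blocks (x ∷ rep k x ++ swapL x ∷ w)

blocks : ∀ u → Blocks u
blocksAfter : ∀ x k u → Blocks (x ∷ rep k x ++ u)

blocks [] = empty
blocks (x ∷ u) = blocksAfter x 0 u

blocksAfter x k [] = subst (λ t → Blocks (x ∷ t)) (sym (++-identityʳ (rep k x))) (run x k)
blocksAfter a k (a ∷ u) = subst (λ t → Blocks (a ∷ t)) (sym (rep-++-∷ k a u)) (blocksAfter a (suc k) u)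
blocksAfter a k (b ∷ u) = block a k (blocks u)
blocksAfter b k (b ∷ u) = subst (λ t → Blocks (b ∷ t)) (sym (rep-++-∷ k b u)) (blocksAfter b (suc k) u)
blocksAfter b k (a ∷ u) = block b k (blocks u)

letterAfter-run : ∀ k → LetterAfter 1 (chr (a ∷ rep k a))
letterAfter-run k = a ∷ [] , itS (d-a (rep k a) (a ∷ []) derivation) it0 , isLetter a
  where
    derivation : φ (index (a ∷ rep k a)) (a ∷ []) ≡ chr (a ∷ rep k a)
    derivation = trans (cong (λ j → φ (suc j) (a ∷ [])) (runFrom-a-run k)) (sym (chr-run k))

letterAfter-block : ∀ k w {n} → LetterAfter n (chr w) → LetterAfter (suc n) (chr (a ∷ rep k a ++ b ∷ w))
letterAfter-block k w (l , it , isL) = l , itS (d-a (rep k a ++ b ∷ w) (chr w) derivation) it , isL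
  where
    derivation : φ (index (a ∷ rep k a ++ b ∷ w)) (chr w) ≡ chr (a ∷ rep k a ++ b ∷ w)
    derivation = trans (cong (λ j → φ (suc j) (chr w)) (runFrom-a-block k w)) (sym (chr-block k w))

letterAfter-chr : ∀ {u} → Blocks u → LetterAfter (depthOf u) (chr u)
letterAfter-chr empty = a ∷ [] , itS d-ab it0 , isLetter a
letterAfter-chr (run a k) = subst (λ n → LetterAfter n (chr (a ∷ rep k a))) (sym (depthOf-run a k)) (letterAfter-run k)
letterAfter-chr (run b k) = subst₂ (λ n t → LetterAfter n (chr (b ∷ t))) (sym (depthOf-run b k)) (bar-rep k a)
  (letterAfter-bar (a ∷ rep k a) (letterAfter-run k))
letterAfter-chr (block a k {w} B) = subst (λ n → LetterAfter n (chr (a ∷ rep k a ++ b ∷ w))) (sym (depthOf-block a k w))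
  (letterAfter-block k w (letterAfter-chr B))
letterAfter-chr (block b k {w} B) = subst₂ (λ n t → LetterAfter n (chr (b ∷ t))) (sym (depthOf-block b k w)) barBlock
  (letterAfter-bar (a ∷ rep k a ++ b ∷ bar w) (letterAfter-block k (bar w) (letterAfter-bar w (letterAfter-chr B))))
  where
    barBlock : bar (rep k a ++ b ∷ bar w) ≡ rep k b ++ a ∷ w
    barBlock = trans (bar-++ (rep k a) (b ∷ bar w)) (cong₂ _++_ (bar-rep k a) (cong (a ∷_) (bar-involutive w)))

depth-chr : ∀ u → HasDepth (chr u) (depthOf u)
depth-chr u = hasDepth (letterAfter-chr (blocks u))

depth-chr-bar : ∀ u → HasDepth (chr (bar u)) (depthOf u)
depth-chr-bar u = hasDepth (letterAfter-bar u (letterAfter-chr (blocks u)))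

mainTheorem11 : (v : Word) →
    Σ ℕ (λ d → HasDepth (chr v) d × HasDepth (chr (rev v)) d
               × HasDepth (chr (bar v)) d × HasDepth (chr (rev (bar v))) d)
mainTheorem11 v =
  depthOf v ,
  depth-chr v ,
  subst (HasDepth (chr (rev v))) (depthOf-reverse v) (depth-chr (rev v)) ,
  depth-chr-bar v ,
  subst₂ HasDepth (cong chr (bar-reverse v)) (depthOf-reverse v) (depth-chr-bar (rev v))
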